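{- Multi-root hollow heaps, with operations as defined in the context, correctly implement all the heap operations (every operation returns the item or heap prescribed by its specification), maintain every heap as a collection of heap-ordered trees, and maintain at all times the following rank invariant: a node $u$ of rank $r$ has exactly $r$ children, of ranks $0,1,\ldots,r-1$, unless $r>2$ and $u$ was made hollow by a decrease-key, in which case $u$ has exactly two children, of ranks $r-2$ and $r-1$.
   Context: Heaps. A heap stores a finite set of items, each with a key from a totally ordered universe, and supports: make-heap() (return an empty heap); find-min($h$) (return an item of minimum key in $h$, or null if $h$ is empty); insert($e,k,h$) (add item $e$, which is in no heap, with key $k$); delete-min($h$) (delete from non-empty $h$ the item that find-min($h$) returns); meld($h_1,h_2$) (return a heap containing all items of the item-disjoint heaps $h_1,h_2$); decrease-key($e,k,h$) (given an item $e$ in $h$ with key greater than $k$, change its key to $k$); delete($e,h$) (delete item $e$ from $h$). Heaps passed as arguments are destroyed; decrease-key and delete are given the location of $e$. Nodes. Nodes hold items: each node holds at most one item, and is full if it holds one and hollow otherwise; each item in a heap is held by exactly one node; a newly created node is full and a hollow node never becomes full again. Each node $u$ has a key $u.key$ (the current key of its item if $u$ is full; if $u$ is hollow, the key its item had just before leaving $u$) and a non-negative integer rank $u.rank$. A tree (or dag) of nodes with arcs from parent to child is heap-ordered if $v.key\le w.key$ for every arc $(v,w)$. For two full roots, link makes the one of larger key (ties broken arbitrarily) a child of the other; the new child is the loser and the other the winner. A ranked link is a link of two roots of equal rank and increases the winner's rank by one. Multi-root hollow heap. It is either empty or a set of heap-ordered rooted trees of nodes, together with a pointer to a full root whose key is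 minimum among all nodes (the minimum node). make-heap returns the empty set of trees; find-min returns the item in the minimum node; meld returns one heap if the other is empty, and otherwise unites the two sets of trees and updates the minimum node; insert($e,k,h$) creates a new full node of rank 0 holding $e$ with key $k$ and melds this one-node heap with $h$. decrease-key($e,k,h$), with $u$ the node holding $e$: if $u$ is a root one may simply set $u.key=k$ and update the minimum node; otherwise create a new node $v$, move $e$ from $u$ to $v$ (so $u$ becomes hollow), set $v.key=k$ and $v.rank=\max\{0,u.rank-2\}$, move every child of $u$ of rank less than $v.rank$ (with its subtree) to become a child of $v$, and meld the tree rooted at $v$ with the heap. delete($e,h$) removes $e$ from the node $u$ holding it, making $u$ hollow; if $u$ is not the minimum node this completes the operation; otherwise, while some root is hollow, destroy such a root, making its children roots; then do ranked links while two roots have equal rank; finally make a root of minimum key the minimum node. delete-min($h$) performs delete on the item in the minimum node. -}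

module Defs where

open import Level using (Level; _⊔_)
open import Data.Nat as ℕ using (ℕ; zero; suc; _∸_; _<?_)
open import Data.Bool using (Bool; true; false)
open import Data.Maybe using (Maybe; just; nothing; maybe)
open import Data.List using (List; []; _∷_; _++_; [_]; map; partition; upTo)
open import Data.List.Relation.Unary.All using (All)
open import Data.List.Relation.Unary.AllPairs using (AllPairs)
open import Data.List.Relation.Binary.Permutation.Propositional using (_↭_)
open import Data.List.Membership.Propositional using (_∈_; _∉_)
open import Data.Product using (Σ; ∃; _×_; _,_; proj₁; proj₂)
open import Data.Sum using (_⊎_)
open import Relation.Nullary using (¬_)
open import Relation.Binary.PropositionalEquality using (_≡_; _≢_)
open import Relation.Binary.Bundles using (TotalOrder)

-- Multi-root hollow heaps, modelled as (nondeterministic) relations on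
-- heap values.  Items come from an arbitrary type, keys from an arbitrary
-- total order.

module HollowHeap {a c ℓ₁ ℓ₂ : Level} (Item : Set a) (O : TotalOrder c ℓ₁ ℓ₂) where

  open TotalOrder O public using () renaming (Carrier to Key; _≤_ to _≤ᴷ_)

  _<ᴷ_ : Key → Key → Set ℓ₂
  x <ᴷ y = ¬ (y ≤ᴷ x)

  -- Data stored in a node.
  --   item     : the item held (nothing = the node is hollow)
  --   key      : u.key (for a hollow node, the key its item had when it left)
  --   rank     : u.rank
  --   dkHollow : ghost flag, true iff the node was made hollow by a
  --              decrease-key (set exactly when that happens, never changed)
  record Info : Set (a ⊔ c) where
    constructor info
    field
      item     : Maybe Item
      key      : Key
      rank     : ℕ
      dkHollow : Bool
  open Info public

  data Tree : Set (a ⊔ c) where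
    node : Info → List Tree → Tree

  infoT : Tree → Info
  infoT (node i _) = i

  keyT : Tree → Key
  keyT t = key (infoT t)

  rankT : Tree → ℕ
  rankT t = rank (infoT t)

  children : Tree → List Tree
  children (node _ cs) = cs

  FullRoot : Tree → Set a
  FullRoot t = Σ Item λ e → item (infoT t) ≡ just e

  -- A heap: empty, or a (nonempty) set of trees given as the tree whose
  -- root is the minimum node (the min pointer) together with the others.
  data Heap : Set (a ⊔ c) where
    empty : Heap
    heap  : (m : Tree) → (others : List Tree) → Heap

  trees : Heap → List Tree
  trees empty        = []
  trees (heap m ts)  = m ∷ ts

  held : Info → List (Item × Key)
  held i = maybe (λ e → [ (e , key i) ]) [] (item i)

  mutual
    itemsT : Tree → List (Item × Key)
    itemsT (node i cs) = held i ++ itemsF cs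

    itemsF : List Tree → List (Item × Key)
    itemsF []       = []
    itemsF (t ∷ ts) = itemsT t ++ itemsF ts

  contents : Heap → List (Item × Key)
  contents h = itemsF (trees h)

  itemsOf : Heap → List Item
  itemsOf h = map proj₁ (contents h)

  data AllNodes {p} (P : Tree → Set p) : Tree → Set (a ⊔ c ⊔ p) where
    node : ∀ {i cs} → P (node i cs) → All (AllNodes P) cs → AllNodes P (node i cs)

  OrderedAt : Tree → Set (a ⊔ c ⊔ ℓ₂)
  OrderedAt (node i cs) = All (λ w → key i ≤ᴷ keyT w) cs

  HeapOrdered : Tree → Set (a ⊔ c ⊔ ℓ₂)
  HeapOrdered = AllNodes OrderedAt

  DKException : Info → Set
  DKException i = (2 ℕ.< rank i) × (dkHollow i ≡ true)

  RankOKAt : Tree → Set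
  RankOKAt (node i cs) =
      (DKException i × (map rankT cs ↭ (rank i ∸ 2) ∷ (rank i ∸ 1) ∷ []))
    ⊎ (¬ DKException i × (map rankT cs ↭ upTo (rank i)))

  RankInvariant : Tree → Set (a ⊔ c)
  RankInvariant = AllNodes RankOKAt

  MinOK : Heap → Set (a ⊔ c ⊔ ℓ₂)
  MinOK empty       = Level.Lift _ Data.Unit.⊤ where import Data.Unit
  MinOK (heap m ts) = FullRoot m × All (AllNodes (λ u → keyT m ≤ᴷ keyT u)) (m ∷ ts)

  Invariant : Heap → Set (a ⊔ c ⊔ ℓ₂)
  Invariant h = All HeapOrdered (trees h) × All RankInvariant (trees h) × MinOK h

  findMin : Heap → Maybe Item
  findMin empty                = nothing
  findMin (heap (node i _) _)  = item i

  data Meld : Heap → Heap → Heap → Set (a ⊔ c ⊔ ℓ₂) where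
    emptyˡ : ∀ {h} → Meld empty h h
    emptyʳ : ∀ {h} → Meld h empty h
    left   : ∀ {m₁ ts₁ m₂ ts₂} → keyT m₁ ≤ᴷ keyT m₂ →
             Meld (heap m₁ ts₁) (heap m₂ ts₂) (heap m₁ (m₂ ∷ ts₁ ++ ts₂))
    right  : ∀ {m₁ ts₁ m₂ ts₂} → keyT m₂ ≤ᴷ keyT m₁ →
             Meld (heap m₁ ts₁) (heap m₂ ts₂) (heap m₂ (m₁ ∷ ts₁ ++ ts₂))

  makeHeap : Heap
  makeHeap = empty

  singleton : Item → Key → Heap
  singleton e k = heap (node (info (just e) k 0 false) []) []

  Insert : Item → Key → Heap → Heap → Set (a ⊔ c ⊔ ℓ₂)
  Insert e k h h' = Meld (singleton e k) h h'

  -- decrease-key, general case: the node u holding e (anywhere in the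
  -- tree) becomes hollow (flag dkHollow set), a new node v holding e with
  -- key k and rank max{0, u.rank-2} takes the children of u of rank less
  -- than v.rank.  Cut e k t t' v : t' is t after this change, v the new tree.
  mutual
    data Cut (e : Item) (k : Key) : Tree → Tree → Tree → Set (a ⊔ c) where
      here  : ∀ {k₀ r d cs} →
              Cut e k (node (info (just e) k₀ r d) cs)
                      (node (info nothing k₀ r true)
                            (proj₂ (partition (λ t → rankT t <? r ∸ 2) cs)))
                      (node (info (just e) k (r ∸ 2) false)
                            (proj₁ (partition (λ t → rankT t <? r ∸ 2) cs)))
      there : ∀ {i cs cs' v} → CutL e k cs cs' v → Cut e k (node i cs) (node i cs') v

    data CutL (e : Item) (k : Key) : List Tree → List Tree → Tree → Set (a ⊔ c) where
      here  : ∀ {t t' ts v} → Cut e k t t' v → CutL e k (t ∷ ts) (t' ∷ ts) v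
      there : ∀ {t ts ts' v} → CutL e k ts ts' v → CutL e k (t ∷ ts) (t ∷ ts') v

  data CutH (e : Item) (k : Key) : Heap → Heap → Tree → Set (a ⊔ c) where
    inMin    : ∀ {m m' ts v} → Cut e k m m' v → CutH e k (heap m ts) (heap m' ts) v
    inOthers : ∀ {m ts ts' v} → CutL e k ts ts' v → CutH e k (heap m ts) (heap m ts') v

  data DecreaseKey (e : Item) (k : Key) : Heap → Heap → Set (a ⊔ c ⊔ ℓ₂) where
    rootMin   : ∀ {k₀ r d cs ts} →
                DecreaseKey e k (heap (node (info (just e) k₀ r d) cs) ts)
                                (heap (node (info (just e) k r d) cs) ts)
    rootNew   : ∀ {m xs ys k₀ r d cs} → k ≤ᴷ keyT m →
                DecreaseKey e k (heap m (xs ++ node (info (just e) k₀ r d) cs ∷ ys))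
                                (heap (node (info (just e) k r d) cs) (m ∷ xs ++ ys))
    rootOld   : ∀ {m xs ys k₀ r d cs} → keyT m ≤ᴷ k →
                DecreaseKey e k (heap m (xs ++ node (info (just e) k₀ r d) cs ∷ ys))
                                (heap m (xs ++ node (info (just e) k r d) cs ∷ ys))
    general   : ∀ {h h₁ h' v} → CutH e k h h₁ v → Meld (heap v []) h₁ h' →
                DecreaseKey e k h h'

  mutual
    data Hollowed (e : Item) : Tree → Tree → Set (a ⊔ c) where
      here  : ∀ {k r d cs} →
              Hollowed e (node (info (just e) k r d) cs) (node (info nothing k r false) cs)
      there : ∀ {i cs cs'} → HollowedL e cs cs' → Hollowed e (node i cs) (node i cs')

    data HollowedL (e : Item) : List Tree → List Tree → Set (a ⊔ c) where
      here  : ∀ {t t' ts} → Hollowed e t t' → HollowedL e (t ∷ ts) (t' ∷ ts)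
      there : ∀ {t ts ts'} → HollowedL e ts ts' → HollowedL e (t ∷ ts) (t ∷ ts')

  data DestroyHollow : List Tree → List Tree → Set (a ⊔ c) where
    done : ∀ {ts} → All FullRoot ts → DestroyHollow ts ts
    step : ∀ {xs ys k r d cs out} →
           DestroyHollow (xs ++ cs ++ ys) out →
           DestroyHollow (xs ++ node (info nothing k r d) cs ∷ ys) out

  incRank : Info → Info
  incRank (info e k r d) = info e k (suc r) d

  data RankedLink : Tree → Tree → Tree → Set (a ⊔ c ⊔ ℓ₂) where
    win₁ : ∀ {i₁ cs₁ i₂ cs₂} → rank i₁ ≡ rank i₂ → key i₁ ≤ᴷ key i₂ →
           RankedLink (node i₁ cs₁) (node i₂ cs₂) (node (incRank i₁) (node i₂ cs₂ ∷ cs₁))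
    win₂ : ∀ {i₁ cs₁ i₂ cs₂} → rank i₁ ≡ rank i₂ → key i₂ ≤ᴷ key i₁ →
           RankedLink (node i₁ cs₁) (node i₂ cs₂) (node (incRank i₂) (node i₁ cs₁ ∷ cs₂))

  data Links : List Tree → List Tree → Set (a ⊔ c ⊔ ℓ₂) where
    done : ∀ {ts} → AllPairs (λ t u → rankT t ≢ rankT u) ts → Links ts ts
    step : ∀ {xs ys zs t₁ t₂ t out} → RankedLink t₁ t₂ t →
           Links (t ∷ xs ++ ys ++ zs) out →
           Links (xs ++ t₁ ∷ ys ++ t₂ ∷ zs) out

  data PickMin : List Tree → Heap → Set (a ⊔ c ⊔ ℓ₂) where
    none : PickMin [] empty
    pick : ∀ {xs t ys} → All (λ u → keyT t ≤ᴷ keyT u) (xs ++ ys) →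
           PickMin (xs ++ t ∷ ys) (heap t (xs ++ ys))

  data Cleanup (ts : List Tree) (h : Heap) : Set (a ⊔ c ⊔ ℓ₂) where
    cleanup : ∀ {ts₁ ts₂} → DestroyHollow ts ts₁ → Links ts₁ ts₂ → PickMin ts₂ h →
              Cleanup ts h

  data Delete (e : Item) : Heap → Heap → Set (a ⊔ c ⊔ ℓ₂) where
    inMinTree : ∀ {i cs cs' ts} → HollowedL e cs cs' →
                Delete e (heap (node i cs) ts) (heap (node i cs') ts)
    inOthers  : ∀ {m ts ts'} → HollowedL e ts ts' →
                Delete e (heap m ts) (heap m ts')
    atMin     : ∀ {k r d cs ts h'} →
                Cleanup (node (info nothing k r false) cs ∷ ts) h' →
                Delete e (heap (node (info (just e) k r d) cs) ts) h'

  data DeleteMin (h h' : Heap) : Set (a ⊔ c ⊔ ℓ₂) where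
    deleteMin : ∀ {e} → findMin h ≡ just e → Delete e h h' → DeleteMin h h'

  Disjoint : Heap → Heap → Set a
  Disjoint h₁ h₂ = ∀ {e} → e ∈ itemsOf h₁ → e ∉ itemsOf h₂

  data Reachable : Heap → Set (a ⊔ c ⊔ ℓ₂) where
    make        : Reachable makeHeap
    insert      : ∀ {e k h h'} → Reachable h → e ∉ itemsOf h →
                  Insert e k h h' → Reachable h'
    meld        : ∀ {h₁ h₂ h} → Reachable h₁ → Reachable h₂ → Disjoint h₁ h₂ →
                  Meld h₁ h₂ h → Reachable h
    decreaseKey : ∀ {e k₀ k h h'} → Reachable h → (e , k₀) ∈ contents h → k <ᴷ k₀ →
                  DecreaseKey e k h h' → Reachable h'
    delete      : ∀ {e h h'} → Reachable h → e ∈ itemsOf h →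
                  Delete e h h' → Reachable h'
    deleteMin   : ∀ {h h'} → Reachable h → DeleteMin h h' → Reachable h'

-- The operations preserve a strengthened invariant: every node is heap-ordered and satisfies the
-- rank invariant, a full node never carries the decrease-key flag, the minimum node is a full root
-- whose key bounds the keys of all other roots, and no item is held twice.  Heap order extends the
-- bound on the roots to all nodes.  A decrease-key only cuts a full node u, whose children thus
-- have ranks exactly 0, …, r-1; the new node v takes those of rank below r-2, leaving u with the
-- two children the exception allows.  A ranked link only joins full roots of equal rank r, so the
-- winner ends up with children of ranks 0, …, r.  As items are distinct, the key passed to
-- decrease-key is that of the node holding the item, and every operation changes the multiset of
-- (item, key) pairs exactly as specified.

module Submission where

open import Defs
open import Level using (Level; Lift; lift; _⊔_)
open import Function using (_∘_)
open import Data.Unit using (⊤; tt)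
open import Data.Empty using (⊥-elim)
open import Data.Bool using (true; false)
open import Data.Maybe using (just; nothing)
open import Data.Nat using (ℕ; suc; _+_; _∸_; _<_; _<?_; _≟_; z≤n; s≤s)
open import Data.Nat.Properties using (n<1+n; n≮n; <⇒≯)
open import Data.Nat.Induction using (<-wellFounded)
open import Induction.WellFounded using (Acc; acc)
open import Data.Product using (Σ; ∃; _×_; _,_; proj₁; proj₂; map₂)
open import Data.Sum as Sum using (_⊎_; inj₁; inj₂)
open import Data.List using (List; []; _∷_; _++_; [_]; map; filter; partition; upTo; length)
open import Data.List.Properties
  using ( partition-defn; filter-++; filter-all; filter-none; filter-accept; filter-reject
        ; upTo-∷ʳ; ++-assoc; ++-identityʳ; map-++ )
open import Data.List.Relation.Unary.All as All using (All; []; _∷_)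
import Data.List.Relation.Unary.All.Properties as All
open import Data.List.Relation.Unary.All.Properties using (all-upTo)
open import Data.List.Relation.Unary.AllPairs using (AllPairs; []; _∷_)
open import Data.List.Relation.Unary.Any using (here; there; any?)
open import Data.List.Relation.Unary.Unique.Propositional using (Unique)
import Data.List.Relation.Unary.Unique.Propositional.Properties as Unique
open import Data.List.Membership.Propositional using (_∈_; _∉_; find)
open import Data.List.Membership.Propositional.Properties using (∈-map⁺; ∈-map⁻; ∈-++⁻; ∈-∃++)
open import Data.List.Relation.Binary.Permutation.Propositional
  using ( _↭_; ↭-refl; ↭-sym; ↭-trans; ↭-reflexive; ↭-prep; ↭-swap; ↭⇒↭ₛ
        ; module PermutationReasoning )
open import Data.List.Relation.Binary.Permutation.Propositional.Properties
  using ( All-resp-↭; ∈-resp-↭; ↭-length; map⁺; ++⁺ˡ; ++⁺ʳ; shift; shifts; ∷↭∷ʳ; filter-↭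
        ; ++-comm )
import Data.List.Relation.Binary.Permutation.Setoid.Properties as PermutationSetoid
open import Relation.Nullary using (does; yes; no)
open import Relation.Unary using (Decidable)
open import Relation.Unary.Properties using (∁?)
open import Relation.Binary.PropositionalEquality
  using (_≡_; _≢_; refl; sym; trans; cong; cong₂; subst; subst₂; setoid; module ≡-Reasoning)
open import Relation.Binary.Bundles using (TotalOrder)

module _ {a b} {A : Set a} {B : Set b} (f : A → B) where

  map-filter : ∀ {p} {P : B → Set p} (P? : Decidable P) → ∀ xs →
               map f (filter (P? ∘ f) xs) ≡ filter P? (map f xs)
  map-filter P? []       = refl
  map-filter P? (x ∷ xs) with does (P? (f x))
  ... | true  = cong (f x ∷_) (map-filter P? xs)
  ... | false = map-filter P? xs

  map-partition : ∀ {p} {P : B → Set p} (P? : Decidable P) → ∀ xs →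
                  let (ys , zs) = partition (P? ∘ f) xs in
                  map f ys ≡ filter P? (map f xs) × map f zs ≡ filter (∁? P?) (map f xs)
  map-partition P? xs rewrite partition-defn (P? ∘ f) xs = map-filter P? xs , map-filter (∁? P?) xs

module _ {a p} {A : Set a} {P : A → Set p} (P? : Decidable P) where

  partition-↭ : ∀ xs → let (ys , zs) = partition P? xs in ys ++ zs ↭ xs
  partition-↭ []       = ↭-refl
  partition-↭ (x ∷ xs) with does (P? x)
  ... | true  = ↭-prep x (partition-↭ xs)
  ... | false = ↭-trans (shift x _ _) (↭-prep x (partition-↭ xs))

  partition-All : ∀ {q} {Q : A → Set q} {xs} → All Q xs →
                  let (ys , zs) = partition P? xs in All Q ys × All Q zs
  partition-All {xs = []}     []         = [] , []
  partition-All {xs = x ∷ xs} (qx ∷ qxs) with does (P? x) | partition-All qxs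
  ... | true  | qys , qzs = qx ∷ qys , qzs
  ... | false | qys , qzs = qys , qx ∷ qzs

∷-upTo-↭ : ∀ r → r ∷ upTo r ↭ upTo (suc r)
∷-upTo-↭ r = ↭-trans (∷↭∷ʳ r (upTo r)) (↭-reflexive (upTo-∷ʳ r))

upTo-2+ : ∀ s → upTo (2 + s) ≡ upTo s ++ s ∷ suc s ∷ []
upTo-2+ s = begin
  upTo (2 + s)                    ≡⟨ upTo-∷ʳ (suc s) ⟨
  upTo (suc s) ++ [ suc s ]       ≡⟨ cong (_++ [ suc s ]) (upTo-∷ʳ s) ⟨
  (upTo s ++ [ s ]) ++ [ suc s ]  ≡⟨ ++-assoc (upTo s) [ s ] [ suc s ] ⟩
  upTo s ++ s ∷ suc s ∷ []        ∎
  where open ≡-Reasoning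

filter-<-upTo : ∀ r → filter (_<? r ∸ 2) (upTo r) ≡ upTo (r ∸ 2)
filter-<-upTo 0             = refl
filter-<-upTo 1             = refl
filter-<-upTo (suc (suc s)) = begin
  filter (_<? s) (upTo (2 + s))                               ≡⟨ cong (filter (_<? s)) (upTo-2+ s) ⟩
  filter (_<? s) (upTo s ++ s ∷ suc s ∷ [])                   ≡⟨ filter-++ (_<? s) (upTo s) _ ⟩
  filter (_<? s) (upTo s) ++ filter (_<? s) (s ∷ suc s ∷ [])  ≡⟨ cong₂ _++_ bottom top ⟩
  upTo s ++ []                                                ≡⟨ ++-identityʳ (upTo s) ⟩
  upTo s                                                      ∎
  where
  open ≡-Reasoning
  bottom : filter (_<? s) (upTo s) ≡ upTo s
  bottom = filter-all (_<? s) (all-upTo s)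
  top : filter (_<? s) (s ∷ suc s ∷ []) ≡ []
  top = trans (filter-reject (_<? s) (n≮n s)) (filter-reject (_<? s) (<⇒≯ (n<1+n s)))

filter-≮-upTo : ∀ s → filter (∁? (_<? s)) (upTo (2 + s)) ≡ s ∷ suc s ∷ []
filter-≮-upTo s = begin
  filter s≤? (upTo (2 + s))                         ≡⟨ cong (filter s≤?) (upTo-2+ s) ⟩
  filter s≤? (upTo s ++ s ∷ suc s ∷ [])             ≡⟨ filter-++ s≤? (upTo s) _ ⟩
  filter s≤? (upTo s) ++ filter s≤? (s ∷ suc s ∷ [])  ≡⟨ cong₂ _++_ bottom top ⟩
  s ∷ suc s ∷ []                                    ∎
  where
  open ≡-Reasoning
  s≤? = ∁? (_<? s)
  bottom : filter s≤? (upTo s) ≡ []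
  bottom = filter-none s≤? (All.map (λ i<s i≮s → i≮s i<s) (all-upTo s))
  top : filter s≤? (s ∷ suc s ∷ []) ≡ s ∷ suc s ∷ []
  top = trans (filter-accept s≤? (n≮n s)) (cong (s ∷_) (filter-accept s≤? (<⇒≯ (n<1+n s))))

module _ {a} {A : Set a} (rank : A → ℕ) (r : ℕ) {xs : List A} (ranks : map rank xs ↭ upTo r) where

  low-ranks : map rank (proj₁ (partition (λ x → rank x <? r ∸ 2) xs)) ↭ upTo (r ∸ 2)
  low-ranks = ↭-trans (↭-reflexive (proj₁ (map-partition rank (_<? r ∸ 2) xs)))
                      (↭-trans (filter-↭ (_<? r ∸ 2) ranks) (↭-reflexive (filter-<-upTo r)))

  high-ranks : map rank (proj₂ (partition (λ x → rank x <? r ∸ 2) xs)) ↭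
               filter (∁? (_<? r ∸ 2)) (upTo r)
  high-ranks = ↭-trans (↭-reflexive (proj₂ (map-partition rank (_<? r ∸ 2) xs)))
                       (filter-↭ (∁? (_<? r ∸ 2)) ranks)

module _ {a} {A : Set a} where

  extract-past : ∀ {x : A} {xs rest} ys → xs ↭ x ∷ rest → ys ++ xs ↭ x ∷ ys ++ rest
  extract-past {x} ys p = ↭-trans (++⁺ˡ ys p) (shift x ys _)

  two-to-front : ∀ xs (y : A) ys z zs → xs ++ y ∷ ys ++ z ∷ zs ↭ y ∷ z ∷ xs ++ ys ++ zs
  two-to-front xs y ys z zs = ↭-trans (shift y xs _) (↭-prep y (extract-past xs (shift z ys zs)))

  bring-forward : ∀ (x : A) xs y ys → x ∷ xs ++ y ∷ ys ↭ y ∷ x ∷ xs ++ ys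
  bring-forward x xs y ys = ↭-trans (↭-prep x (shift y xs ys)) (↭-swap x y ↭-refl)

module _ {a b} {A : Set a} {B : Set b} where

  unique-resp-↭ : {ps qs : List (A × B)} → ps ↭ qs →
                  Unique (map proj₁ ps) → Unique (map proj₁ qs)
  unique-resp-↭ p = PermutationSetoid.Unique-resp-↭ (setoid A) (↭⇒↭ₛ (map⁺ proj₁ p))

  unique-++ : {ps qs : List (A × B)} → Unique (map proj₁ ps) → Unique (map proj₁ qs) →
              (∀ {x} → x ∈ map proj₁ ps → x ∉ map proj₁ qs) → Unique (map proj₁ (ps ++ qs))
  unique-++ {ps} {qs} u v disjoint rewrite map-++ proj₁ ps qs =
    Unique.++⁺ u v (λ (x∈ps , x∈qs) → disjoint x∈ps x∈qs)

  key-unique : ∀ {ps rest} {x : A} {y y′ : B} → Unique (map proj₁ ps) →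
               ps ↭ (x , y) ∷ rest → (x , y′) ∈ ps → y′ ≡ y
  key-unique u p mem with ∈-resp-↭ p mem | unique-resp-↭ p u
  ... | here refl  | _         = refl
  ... | there mem′ | x∉ ∷ _    = ⊥-elim (All.lookup x∉ (∈-map⁺ proj₁ mem′) refl)

module Correctness {a c ℓ₁ ℓ₂ : Level} (Item : Set a) (O : TotalOrder c ℓ₁ ℓ₂) where

  open HollowHeap Item O
  open TotalOrder O using () renaming (refl to ≤ᴷ-refl; trans to ≤ᴷ-trans; total to ≤ᴷ-total)
  open import Relation.Binary.Properties.TotalOrder O using (≰⇒≥)

  <ᴷ⇒≤ᴷ : ∀ {x y} → x <ᴷ y → x ≤ᴷ y
  <ᴷ⇒≤ᴷ = ≰⇒≥

  mutual
    mapAllNodes : ∀ {p q} {P : Tree → Set p} {Q : Tree → Set q} →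
                  (∀ {t} → P t → Q t) → ∀ {t} → AllNodes P t → AllNodes Q t
    mapAllNodes f (node pt pcs) = node (f pt) (mapAllNodesF f pcs)

    mapAllNodesF : ∀ {p q} {P : Tree → Set p} {Q : Tree → Set q} →
                   (∀ {t} → P t → Q t) → ∀ {ts} → All (AllNodes P) ts → All (AllNodes Q) ts
    mapAllNodesF f []         = []
    mapAllNodesF f (pt ∷ pts) = mapAllNodes f pt ∷ mapAllNodesF f pts

  itemsF-++ : ∀ xs ys → itemsF (xs ++ ys) ≡ itemsF xs ++ itemsF ys
  itemsF-++ []       ys = refl
  itemsF-++ (x ∷ xs) ys = trans (cong (itemsT x ++_) (itemsF-++ xs ys))
                                (sym (++-assoc (itemsT x) (itemsF xs) (itemsF ys)))

  itemsF-↭ : ∀ {xs ys} → xs ↭ ys → itemsF xs ↭ itemsF ys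
  itemsF-↭ _↭_.refl          = ↭-refl
  itemsF-↭ (_↭_.prep x p)    = ++⁺ˡ (itemsT x) (itemsF-↭ p)
  itemsF-↭ (_↭_.swap x y p)  =
    ↭-trans (shifts (itemsT x) (itemsT y)) (++⁺ˡ (itemsT y) (++⁺ˡ (itemsT x) (itemsF-↭ p)))
  itemsF-↭ (_↭_.trans p q)   = ↭-trans (itemsF-↭ p) (itemsF-↭ q)

  AtLeast : Key → Tree → Set ℓ₂
  AtLeast x t = x ≤ᴷ keyT t

  mutual
    heapOrdered⇒bounded : ∀ {x t} → HeapOrdered t → AtLeast x t → AllNodes (AtLeast x) t
    heapOrdered⇒bounded (node ord hos) x≤t =
      node x≤t (heapOrderedF⇒bounded hos (All.map (≤ᴷ-trans x≤t) ord))

    heapOrderedF⇒bounded : ∀ {x ts} → All HeapOrdered ts → All (AtLeast x) ts →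
                           All (AllNodes (AtLeast x)) ts
    heapOrderedF⇒bounded []         []       = []
    heapOrderedF⇒bounded (ho ∷ hos) (b ∷ bs) = heapOrdered⇒bounded ho b ∷ heapOrderedF⇒bounded hos bs

  mutual
    bounded⇒items : ∀ {x t} → AllNodes (AtLeast x) t → All (λ p → x ≤ᴷ proj₂ p) (itemsT t)
    bounded⇒items {t = node (info nothing  _ _ _) _} (node _ bcs)  = boundedF⇒items bcs
    bounded⇒items {t = node (info (just _) _ _ _) _} (node b bcs)  = b ∷ boundedF⇒items bcs

    boundedF⇒items : ∀ {x ts} → All (AllNodes (AtLeast x)) ts →
                     All (λ p → x ≤ᴷ proj₂ p) (itemsF ts)
    boundedF⇒items []         = []
    boundedF⇒items (bt ∷ bts) = All.++⁺ (bounded⇒items bt) (boundedF⇒items bts)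

  UnflaggedIfFull : Info → Set
  UnflaggedIfFull (info nothing  _ _ _) = ⊤
  UnflaggedIfFull (info (just _) _ _ d) = d ≡ false

  WellFormedAt : Tree → Set (a ⊔ c ⊔ ℓ₂)
  WellFormedAt t = OrderedAt t × RankOKAt t × UnflaggedIfFull (infoT t)

  WellFormed : Tree → Set (a ⊔ c ⊔ ℓ₂)
  WellFormed = AllNodes WellFormedAt

  MinFull : Heap → Set a
  MinFull empty      = Lift a ⊤
  MinFull (heap m _) = FullRoot m

  MinBelowRoots : Heap → Set (a ⊔ c ⊔ ℓ₂)
  MinBelowRoots empty       = Lift _ ⊤
  MinBelowRoots (heap m ts) = All (AtLeast (keyT m)) ts

  record Shaped (h : Heap) : Set (a ⊔ c ⊔ ℓ₂) where
    constructor shaped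
    field
      wellFormed : All WellFormed (trees h)
      minFull    : MinFull h
      minBelow   : MinBelowRoots h

  Valid : Heap → Set (a ⊔ c ⊔ ℓ₂)
  Valid h = Shaped h × Unique (itemsOf h)

  shaped⇒invariant : ∀ {h} → Shaped h → Invariant h
  shaped⇒invariant {empty}     (shaped [] _ _) = [] , [] , lift tt
  shaped⇒invariant {heap m ts} (shaped ws full below) =
    All.map (mapAllNodes proj₁) ws , All.map (mapAllNodes (proj₁ ∘ proj₂)) ws ,
    full , heapOrderedF⇒bounded (All.map (mapAllNodes proj₁) ws) (≤ᴷ-refl ∷ below)

  findMin-nothing : ∀ {h} → MinFull h → findMin h ≡ nothing → contents h ≡ []
  findMin-nothing {empty}                   _       _       = refl
  findMin-nothing {heap (node _ _) _} (_ , full) nothing≡ with trans (sym nothing≡) full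
  ... | ()

  findMin-just : ∀ {h e} → Invariant h → findMin h ≡ just e →
                 Σ Key λ k → (e , k) ∈ contents h × All (λ p → k ≤ᴷ proj₂ p) (contents h)
  findMin-just {heap (node (info _ k _ _) _) _} (_ , _ , _ , bounds) refl =
    k , here refl , boundedF⇒items bounds

  meld-exists : ∀ h₁ h₂ → ∃ λ h → Meld h₁ h₂ h
  meld-exists empty         h₂            = h₂ , emptyˡ
  meld-exists (heap m ts)   empty         = heap m ts , emptyʳ
  meld-exists (heap m₁ ts₁) (heap m₂ ts₂) with ≤ᴷ-total (keyT m₁) (keyT m₂)
  ... | inj₁ m₁≤m₂ = _ , left m₁≤m₂
  ... | inj₂ m₂≤m₁ = _ , right m₂≤m₁

  meld-trees : ∀ {h₁ h₂ h} → Meld h₁ h₂ h → trees h ↭ trees h₁ ++ trees h₂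
  meld-trees emptyˡ                            = ↭-refl
  meld-trees (emptyʳ {h})                      = ↭-reflexive (sym (++-identityʳ (trees h)))
  meld-trees (left {m₁} {ts₁} {m₂} {ts₂} _)    = ↭-prep m₁ (↭-sym (shift m₂ ts₁ ts₂))
  meld-trees (right {m₁} {ts₁} {m₂} {ts₂} _)   = ↭-sym (shift m₂ (m₁ ∷ ts₁) ts₂)

  meld-contents : ∀ {h₁ h₂ h} → Meld h₁ h₂ h → contents h ↭ contents h₁ ++ contents h₂
  meld-contents {h₁} {h₂} m =
    ↭-trans (itemsF-↭ (meld-trees m)) (↭-reflexive (itemsF-++ (trees h₁) (trees h₂)))

  meld-wellFormed : ∀ {h₁ h₂ h} → Meld h₁ h₂ h →
                    All WellFormed (trees h₁) → All WellFormed (trees h₂) → All WellFormed (trees h)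
  meld-wellFormed m ws₁ ws₂ = All-resp-↭ (↭-sym (meld-trees m)) (All.++⁺ ws₁ ws₂)

  meld-minFull : ∀ {h₁ h₂ h} → Meld h₁ h₂ h → MinFull h₁ → MinFull h₂ → MinFull h
  meld-minFull emptyˡ    _     full₂ = full₂
  meld-minFull emptyʳ    full₁ _     = full₁
  meld-minFull (left _)  full₁ _     = full₁
  meld-minFull (right _) _     full₂ = full₂

  meld-minBelow : ∀ {h₁ h₂ h} → Meld h₁ h₂ h →
                  MinBelowRoots h₁ → MinBelowRoots h₂ → MinBelowRoots h
  meld-minBelow emptyˡ        _  b₂ = b₂
  meld-minBelow emptyʳ        b₁ _  = b₁
  meld-minBelow (left m₁≤m₂)  b₁ b₂ = m₁≤m₂ ∷ All.++⁺ b₁ (All.map (≤ᴷ-trans m₁≤m₂) b₂)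
  meld-minBelow (right m₂≤m₁) b₁ b₂ = m₂≤m₁ ∷ All.++⁺ (All.map (≤ᴷ-trans m₂≤m₁) b₁) b₂

  meld-valid : ∀ {h₁ h₂ h} → Valid h₁ → Valid h₂ → Disjoint h₁ h₂ → Meld h₁ h₂ h → Valid h
  meld-valid (shaped ws₁ full₁ b₁ , u₁) (shaped ws₂ full₂ b₂ , u₂) disjoint m =
    shaped (meld-wellFormed m ws₁ ws₂) (meld-minFull m full₁ full₂) (meld-minBelow m b₁ b₂) ,
    unique-resp-↭ (↭-sym (meld-contents m)) (unique-++ u₁ u₂ disjoint)

  singleton-valid : ∀ e k → Valid (singleton e k)
  singleton-valid e k =
    shaped (node ([] , inj₂ ((λ ()) , ↭-refl) , refl) [] ∷ []) (e , refl) [] , [] ∷ []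

  SameRoot : Tree → Tree → Set c
  SameRoot t t′ = keyT t ≡ keyT t′ × rankT t ≡ rankT t′

  SameRoots : List Tree → List Tree → Set c
  SameRoots ts ts′ = map keyT ts ≡ map keyT ts′ × map rankT ts ≡ map rankT ts′

  sameRoots-here : ∀ {t t′ ts} → SameRoot t t′ → SameRoots (t ∷ ts) (t′ ∷ ts)
  sameRoots-here (k≡ , r≡) = cong₂ _∷_ k≡ refl , cong₂ _∷_ r≡ refl

  sameRoots-there : ∀ {t ts ts′} → SameRoots ts ts′ → SameRoots (t ∷ ts) (t ∷ ts′)
  sameRoots-there (k≡ , r≡) = cong (_ ∷_) k≡ , cong (_ ∷_) r≡

  sameRoots-All : ∀ {p} {P : Key → Set p} {ts ts′} → SameRoots ts ts′ →
                  All (λ t → P (keyT t)) ts → All (λ t → P (keyT t)) ts′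
  sameRoots-All {P = P} (k≡ , _) pts = All.map⁻ (subst (All P) k≡ (All.map⁺ pts))

  wellFormedAt-resp : ∀ {i cs cs′} → SameRoots cs cs′ →
                      WellFormedAt (node i cs) → WellFormedAt (node i cs′)
  wellFormedAt-resp {i} {cs} {cs′} same@(_ , r≡) (ord , rankOK , flag) =
    sameRoots-All {P = key i ≤ᴷ_} same ord , Sum.map (map₂ ranks) (map₂ ranks) rankOK , flag
    where
    ranks : ∀ {rs} → map rankT cs ↭ rs → map rankT cs′ ↭ rs
    ranks = subst (_↭ _) r≡

  lowerKey-wellFormed : ∀ {e k κ r d cs} → k ≤ᴷ κ →
    WellFormed (node (info (just e) κ r d) cs) → WellFormed (node (info (just e) k r d) cs)
  lowerKey-wellFormed k≤κ (node (ord , rankOK , flag) wcs) =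
    node (All.map (≤ᴷ-trans k≤κ) ord , rankOK , flag) wcs

  -- u keeps its children of rank at least r ∸ 2; for r ≤ 2 these are all of them.
  hollowed-rankOK : ∀ r {k₀ cs} → map rankT cs ↭ upTo r →
    RankOKAt (node (info nothing k₀ r true) (proj₂ (partition (λ t → rankT t <? r ∸ 2) cs)))
  hollowed-rankOK 0 ranks = inj₂ ((λ ()) , high-ranks rankT 0 ranks)
  hollowed-rankOK 1 ranks = inj₂ ((λ { (s≤s () , _) }) , high-ranks rankT 1 ranks)
  hollowed-rankOK 2 ranks = inj₂ ((λ { (s≤s (s≤s ()) , _) }) , high-ranks rankT 2 ranks)
  hollowed-rankOK (suc (suc (suc s))) ranks =
    inj₁ ( (s≤s (s≤s (s≤s z≤n)) , refl)
         , ↭-trans (high-ranks rankT _ ranks) (↭-reflexive (filter-≮-upTo (suc s))) )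

  module _ {e : Item} {k : Key} where

    mutual
      oldKey : ∀ {t t′ v} → Cut e k t t′ v → Key
      oldKey (here {k₀}) = k₀
      oldKey (there l)   = oldKeyL l

      oldKeyL : ∀ {ts ts′ v} → CutL e k ts ts′ v → Key
      oldKeyL (here c)  = oldKey c
      oldKeyL (there l) = oldKeyL l

    cut-root : ∀ {t t′ v} → Cut e k t t′ v → SameRoot t t′
    cut-root here      = refl , refl
    cut-root (there _) = refl , refl

    cutL-roots : ∀ {ts ts′ v} → CutL e k ts ts′ v → SameRoots ts ts′
    cutL-roots (here {t} {t′} {ts} c) = sameRoots-here {t} {t′} {ts} (cut-root c)
    cutL-roots (there {t} l)          = sameRoots-there {t} (cutL-roots l)

    cut-fullRoot : ∀ {t t′ v} (c : Cut e k t t′ v) → FullRoot t →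
                   FullRoot t′ ⊎ keyT t ≡ oldKey c
    cut-fullRoot here      _    = inj₂ refl
    cut-fullRoot (there _) full = inj₁ full

    mutual
      cut-newRoot : ∀ {t t′ v} → Cut e k t t′ v → FullRoot v × keyT v ≡ k
      cut-newRoot here      = (e , refl) , refl
      cut-newRoot (there l) = cutL-newRoot l

      cutL-newRoot : ∀ {ts ts′ v} → CutL e k ts ts′ v → FullRoot v × keyT v ≡ k
      cutL-newRoot (here c)  = cut-newRoot c
      cutL-newRoot (there l) = cutL-newRoot l

    mutual
      cut-items : ∀ {t t′ v} (c : Cut e k t t′ v) → Σ (List (Item × Key)) λ rest →
                  (itemsT t ↭ (e , oldKey c) ∷ rest) × (itemsT v ++ itemsT t′ ↭ (e , k) ∷ rest)
      cut-items (here {r = r} {cs = cs}) =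
        itemsF cs , ↭-refl ,
        ↭-prep (e , k)
          (↭-trans (↭-reflexive (sym (itemsF-++ low high))) (itemsF-↭ (partition-↭ low? cs)))
        where
        low? = λ t → rankT t <? r ∸ 2
        low = proj₁ (partition low? cs)
        high = proj₂ (partition low? cs)
      cut-items (there {i} {v = v} l) with cutL-items l
      ... | rest , before , after =
        held i ++ rest , extract-past (held i) before ,
        ↭-trans (shifts (itemsT v) (held i)) (extract-past (held i) after)

      cutL-items : ∀ {ts ts′ v} (l : CutL e k ts ts′ v) → Σ (List (Item × Key)) λ rest →
                   (itemsF ts ↭ (e , oldKeyL l) ∷ rest) × (itemsT v ++ itemsF ts′ ↭ (e , k) ∷ rest)
      cutL-items (here {t' = t′} {ts} {v} c) with cut-items c
      ... | rest , before , after =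
        rest ++ itemsF ts , ++⁺ʳ (itemsF ts) before ,
        ↭-trans (↭-reflexive (sym (++-assoc (itemsT v) (itemsT t′) (itemsF ts))))
                (++⁺ʳ (itemsF ts) after)
      cutL-items (there {t} {v = v} l) with cutL-items l
      ... | rest , before , after =
        itemsT t ++ rest , extract-past (itemsT t) before ,
        ↭-trans (shifts (itemsT v) (itemsT t)) (extract-past (itemsT t) after)

    mutual
      cut-wellFormed : ∀ {t t′ v} (c : Cut e k t t′ v) → WellFormed t →
                       WellFormed t′ × (k ≤ᴷ oldKey c → WellFormed v)
      cut-wellFormed here (node (_ , inj₁ ((_ , ()) , _) , refl) _)
      cut-wellFormed (here {k₀} {r}) (node (ord , inj₂ (_ , ranks) , refl) wcs) =
        node (proj₂ (partition-All low? ord) , hollowed-rankOK r {k₀} ranks , tt)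
             (proj₂ (partition-All low? wcs)) ,
        λ k≤k₀ → node (proj₁ (partition-All low? (All.map (≤ᴷ-trans k≤k₀) ord)) ,
                       inj₂ ((λ { (_ , ()) }) , low-ranks rankT r ranks) , refl)
                      (proj₁ (partition-All low? wcs))
        where low? = λ t → rankT t <? r ∸ 2
      cut-wellFormed (there {i} l) (node wf wcs) with cutL-wellFormed l wcs
      ... | wcs′ , wv = node (wellFormedAt-resp {i} (cutL-roots l) wf) wcs′ , wv

      cutL-wellFormed : ∀ {ts ts′ v} (l : CutL e k ts ts′ v) → All WellFormed ts →
                        All WellFormed ts′ × (k ≤ᴷ oldKeyL l → WellFormed v)
      cutL-wellFormed (here c) (w ∷ ws) with cut-wellFormed c w
      ... | w′ , wv = w′ ∷ ws , wv
      cutL-wellFormed (there l) (w ∷ ws) with cutL-wellFormed l ws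
      ... | ws′ , wv = w ∷ ws′ , wv

    mutual
      cut-exists : ∀ {k₀} t → (e , k₀) ∈ itemsT t → ∃ λ t′ → ∃ λ v → Cut e k t t′ v
      cut-exists (node (info (just _) _ _ _) _)  (here refl) = _ , _ , here
      cut-exists (node (info (just _) _ _ _) cs) (there mem) with cutL-exists cs mem
      ... | _ , _ , l = _ , _ , there l
      cut-exists (node (info nothing _ _ _) cs)  mem         with cutL-exists cs mem
      ... | _ , _ , l = _ , _ , there l

      cutL-exists : ∀ {k₀} ts → (e , k₀) ∈ itemsF ts →
                    ∃ λ ts′ → ∃ λ v → CutL e k ts ts′ v
      cutL-exists (t ∷ ts) mem with ∈-++⁻ (itemsT t) mem
      ... | inj₁ mem′ with cut-exists t mem′
      ...   | _ , _ , c = _ , _ , here c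
      cutL-exists (t ∷ ts) mem | inj₂ mem′ with cutL-exists ts mem′
      ...   | _ , _ , l = _ , _ , there l

    asCutL : ∀ {h h₁ v} → CutH e k h h₁ v → CutL e k (trees h) (trees h₁) v
    asCutL (inMin c)    = here c
    asCutL (inOthers l) = there l

    oldKeyH : ∀ {h h₁ v} → CutH e k h h₁ v → Key
    oldKeyH c = oldKeyL (asCutL c)

    cutH-minBelow : ∀ {h h₁ v} → CutH e k h h₁ v → MinBelowRoots h → MinBelowRoots h₁
    cutH-minBelow (inMin {ts = ts} c) below = subst (λ x → All (AtLeast x) ts) (proj₁ (cut-root c)) below
    cutH-minBelow (inOthers {m} l)    below = sameRoots-All {P = keyT m ≤ᴷ_} (cutL-roots l) below

    cutH-exists : ∀ {k₀} h → (e , k₀) ∈ contents h → ∃ λ h₁ → ∃ λ v → CutH e k h h₁ v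
    cutH-exists (heap m ts) mem with cutL-exists (m ∷ ts) mem
    ... | _ , _ , here c  = _ , _ , inMin c
    ... | _ , _ , there l = _ , _ , inOthers l

    -- If the cut node was the minimum root it is now hollow, but then it loses
    -- the comparison with v, whose key is smaller.
    meld-cut-minFull : ∀ {h h₁ v h′} (c : CutH e k h h₁ v) → Meld (heap v []) h₁ h′ →
                       k <ᴷ oldKeyH c → MinFull h → MinFull h′
    meld-cut-minFull (inMin c)    (left _)    _  _    = proj₁ (cut-newRoot c)
    meld-cut-minFull (inOthers l) (left _)    _  _    = proj₁ (cutL-newRoot l)
    meld-cut-minFull (inOthers l) (right _)   _  full = full
    meld-cut-minFull (inMin c)    (right m≤v) lt full with cut-fullRoot c full
    ... | inj₁ full′ = full′
    ... | inj₂ m≡old =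
      ⊥-elim (lt (subst₂ _≤ᴷ_ (trans (sym (proj₁ (cut-root c))) m≡old) (proj₂ (cut-newRoot c)) m≤v))

    oldKeyDK : ∀ {h h′} → DecreaseKey e k h h′ → Key
    oldKeyDK (rootMin {k₀})          = k₀
    oldKeyDK (rootNew {k₀ = k₀} _)   = k₀
    oldKeyDK (rootOld {k₀ = k₀} _)   = k₀
    oldKeyDK (general c _)           = oldKeyH c

    decreaseKey-contents : ∀ {h h′} (d : DecreaseKey e k h h′) → Σ (List (Item × Key)) λ rest →
                           (contents h ↭ (e , oldKeyDK d) ∷ rest) × (contents h′ ↭ (e , k) ∷ rest)
    decreaseKey-contents rootMin                     = _ , ↭-refl , ↭-refl
    decreaseKey-contents (rootNew {m} {xs} {ys} _)   = _ , itemsF-↭ (bring-forward m xs _ ys) , ↭-refl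
    decreaseKey-contents (rootOld {m} {xs} {ys} _)   =
      _ , itemsF-↭ (bring-forward m xs _ ys) , itemsF-↭ (bring-forward m xs _ ys)
    decreaseKey-contents (general {h₁ = h₁} {v = v} c m) with cutL-items (asCutL c)
    ... | rest , before , after =
      rest , before ,
      ↭-trans (meld-contents m)
              (↭-trans (↭-reflexive (cong (_++ contents h₁) (++-identityʳ (itemsT v)))) after)

    decreaseKey-shaped : ∀ {h h′} (d : DecreaseKey e k h h′) → k <ᴷ oldKeyDK d →
                         Shaped h → Shaped h′
    decreaseKey-shaped rootMin lt (shaped (w ∷ ws) _ below) =
      shaped (lowerKey-wellFormed k≤k₀ w ∷ ws) (e , refl) (All.map (≤ᴷ-trans k≤k₀) below)
      where k≤k₀ = <ᴷ⇒≤ᴷ lt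
    decreaseKey-shaped (rootNew {m} {xs} {ys} {k₀} {r} {d} {cs} k≤m) lt (shaped (wm ∷ ws) _ below)
      with All-resp-↭ (shift (node (info (just e) k₀ r d) cs) xs ys) ws
         | All-resp-↭ (shift (node (info (just e) k₀ r d) cs) xs ys) below
    ... | wu ∷ ws′ | _ ∷ below′ =
      shaped (lowerKey-wellFormed (<ᴷ⇒≤ᴷ lt) wu ∷ wm ∷ ws′) (e , refl)
             (k≤m ∷ All.map (≤ᴷ-trans k≤m) below′)
    decreaseKey-shaped (rootOld {m} {xs} {ys} {k₀} {r} {d} {cs} m≤k) lt (shaped (wm ∷ ws) full below)
      with All-resp-↭ (shift (node (info (just e) k₀ r d) cs) xs ys) ws
         | All-resp-↭ (shift (node (info (just e) k₀ r d) cs) xs ys) below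
    ... | wu ∷ ws′ | _ ∷ below′ =
      shaped (wm ∷ All-resp-↭ unshift (lowerKey-wellFormed (<ᴷ⇒≤ᴷ lt) wu ∷ ws′)) full
             (All-resp-↭ unshift (m≤k ∷ below′))
      where unshift = ↭-sym (shift (node (info (just e) k r d) cs) xs ys)
    decreaseKey-shaped (general c m) lt (shaped ws full below) with cutL-wellFormed (asCutL c) ws
    ... | ws₁ , wv =
      shaped (meld-wellFormed m (wv (<ᴷ⇒≤ᴷ lt) ∷ []) ws₁) (meld-cut-minFull c m lt full)
             (meld-minBelow m [] (cutH-minBelow c below))

  decreaseKey-exists : ∀ {e k₀ h} k → (e , k₀) ∈ contents h → ∃ λ h′ → DecreaseKey e k h h′
  decreaseKey-exists {e} {h = h} k mem with cutH-exists {e} {k} h mem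
  ... | h₁ , v , c = _ , general c (proj₂ (meld-exists (heap v []) h₁))

  decreaseKey-correct : ∀ {e k₀ k h h′} → Valid h → (e , k₀) ∈ contents h → k <ᴷ k₀ →
    DecreaseKey e k h h′ →
    Valid h′ × Σ (List (Item × Key)) λ rest →
                 (contents h ↭ (e , k₀) ∷ rest) × (contents h′ ↭ (e , k) ∷ rest)
  decreaseKey-correct (s , u) mem lt d with decreaseKey-contents d
  ... | rest , before , after with key-unique u before mem
  ... | refl = (decreaseKey-shaped d lt s , unique-resp-↭ (↭-sym after) (unique-resp-↭ before u)) ,
               rest , before , after

  module _ {e : Item} where

    mutual
      hollowed-items : ∀ {t t′} → Hollowed e t t′ →
                       Σ Key λ k → itemsT t ↭ (e , k) ∷ itemsT t′
      hollowed-items (here {k}) = k , ↭-refl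
      hollowed-items (there {i} l) with hollowedL-items l
      ... | k , p = k , extract-past (held i) p

      hollowedL-items : ∀ {ts ts′} → HollowedL e ts ts′ →
                        Σ Key λ k → itemsF ts ↭ (e , k) ∷ itemsF ts′
      hollowedL-items (here {ts = ts} h) with hollowed-items h
      ... | k , p = k , ++⁺ʳ (itemsF ts) p
      hollowedL-items (there {t} l) with hollowedL-items l
      ... | k , p = k , extract-past (itemsT t) p

    hollowed-root : ∀ {t t′} → Hollowed e t t′ → SameRoot t t′
    hollowed-root here      = refl , refl
    hollowed-root (there _) = refl , refl

    hollowedL-roots : ∀ {ts ts′} → HollowedL e ts ts′ → SameRoots ts ts′
    hollowedL-roots (here {t} {t′} {ts} h) = sameRoots-here {t} {t′} {ts} (hollowed-root h)
    hollowedL-roots (there {t} l)          = sameRoots-there {t} (hollowedL-roots l)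

    mutual
      hollowed-wellFormed : ∀ {t t′} → Hollowed e t t′ → WellFormed t → WellFormed t′
      hollowed-wellFormed here          (node (ord , rankOK , refl) wcs) = node (ord , rankOK , tt) wcs
      hollowed-wellFormed (there {i} l) (node wf wcs) =
        node (wellFormedAt-resp {i} (hollowedL-roots l) wf) (hollowedL-wellFormed l wcs)

      hollowedL-wellFormed : ∀ {ts ts′} → HollowedL e ts ts′ →
                             All WellFormed ts → All WellFormed ts′
      hollowedL-wellFormed (here h)  (w ∷ ws) = hollowed-wellFormed h w ∷ ws
      hollowedL-wellFormed (there l) (w ∷ ws) = w ∷ hollowedL-wellFormed l ws

    mutual
      hollowed-exists : ∀ {k₀} t → (e , k₀) ∈ itemsT t → ∃ λ t′ → Hollowed e t t′
      hollowed-exists (node (info (just _) _ _ _) _)  (here refl) = _ , here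
      hollowed-exists (node (info (just _) _ _ _) cs) (there mem) = _ , there (proj₂ (hollowedL-exists cs mem))
      hollowed-exists (node (info nothing _ _ _) cs)  mem         = _ , there (proj₂ (hollowedL-exists cs mem))

      hollowedL-exists : ∀ {k₀} ts → (e , k₀) ∈ itemsF ts → ∃ λ ts′ → HollowedL e ts ts′
      hollowedL-exists (t ∷ ts) mem with ∈-++⁻ (itemsT t) mem
      ... | inj₁ mem′ = _ , here (proj₂ (hollowed-exists t mem′))
      ... | inj₂ mem′ = _ , there (proj₂ (hollowedL-exists ts mem′))

  destroy-contents : ∀ {ts out} → DestroyHollow ts out → itemsF out ≡ itemsF ts
  destroy-contents (done _) = refl
  destroy-contents {out = out} (step {xs} {ys} {k} {r} {d} {cs} dh) = begin
    itemsF out                                               ≡⟨ destroy-contents dh ⟩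
    itemsF (xs ++ cs ++ ys)                                  ≡⟨ itemsF-++ xs (cs ++ ys) ⟩
    itemsF xs ++ itemsF (cs ++ ys)                           ≡⟨ cong (itemsF xs ++_) (itemsF-++ cs ys) ⟩
    itemsF xs ++ itemsF (node (info nothing k r d) cs ∷ ys)  ≡⟨ itemsF-++ xs _ ⟨
    itemsF (xs ++ node (info nothing k r d) cs ∷ ys)         ∎
    where open ≡-Reasoning

  destroy-wellFormed : ∀ {ts out} → DestroyHollow ts out → All WellFormed ts → All WellFormed out
  destroy-wellFormed (done _)       ws = ws
  destroy-wellFormed (step {xs} dh) ws with All.++⁻ xs ws
  ... | wxs , node _ wcs ∷ wys = destroy-wellFormed dh (All.++⁺ wxs (All.++⁺ wcs wys))

  destroy-fullRoots : ∀ {ts out} → DestroyHollow ts out → All FullRoot out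
  destroy-fullRoots (done fulls) = fulls
  destroy-fullRoots (step dh)    = destroy-fullRoots dh

  attach-wellFormed : ∀ {e k r d cs t} → rankT t ≡ r → k ≤ᴷ keyT t →
           WellFormed (node (info (just e) k r d) cs) → WellFormed t →
           WellFormed (node (info (just e) k (suc r) d) (t ∷ cs))
  attach-wellFormed refl _   (node (_ , inj₁ ((_ , ()) , _) , refl) _) _
  attach-wellFormed refl k≤t (node (ord , inj₂ (_ , ranks) , refl) wcs) wt =
    node (k≤t ∷ ord , inj₂ ((λ { (_ , ()) }) , ↭-trans (↭-prep _ ranks) (∷-upTo-↭ _)) , refl)
         (wt ∷ wcs)

  link-wellFormed : ∀ {t₁ t₂ t} → RankedLink t₁ t₂ t → FullRoot t₁ → FullRoot t₂ →
                    WellFormed t₁ → WellFormed t₂ → WellFormed t × FullRoot t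
  link-wellFormed (win₁ r≡ k≤) (e , refl) _ w₁ w₂ = attach-wellFormed (sym r≡) k≤ w₁ w₂ , e , refl
  link-wellFormed (win₂ r≡ k≤) _ (e , refl) w₁ w₂ = attach-wellFormed r≡ k≤ w₂ w₁ , e , refl

  link-items : ∀ {t₁ t₂ t} → RankedLink t₁ t₂ t → itemsT t ↭ itemsT t₁ ++ itemsT t₂
  link-items (win₁ {i₁@(info _ _ _ _)} {cs₁} {i₂} {cs₂} _ _) =
    ↭-trans (++⁺ˡ (held i₁) (++-comm (itemsT (node i₂ cs₂)) (itemsF cs₁)))
            (↭-reflexive (sym (++-assoc (held i₁) (itemsF cs₁) (itemsT (node i₂ cs₂)))))
  link-items (win₂ {i₁} {cs₁} {i₂@(info _ _ _ _)} _ _) = shifts (held i₂) (itemsT (node i₁ cs₁))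

  links-contents : ∀ {ts out} → Links ts out → itemsF out ↭ itemsF ts
  links-contents (done _) = ↭-refl
  links-contents {out = out} (step {xs} {ys} {zs} {t₁} {t₂} {t} l ls) = begin
    itemsF out                               ↭⟨ links-contents ls ⟩
    itemsT t ++ itemsF rest                  ↭⟨ ++⁺ʳ (itemsF rest) (link-items l) ⟩
    (itemsT t₁ ++ itemsT t₂) ++ itemsF rest  ≡⟨ ++-assoc (itemsT t₁) (itemsT t₂) (itemsF rest) ⟩
    itemsF (t₁ ∷ t₂ ∷ rest)                  ↭⟨ itemsF-↭ (two-to-front xs t₁ ys t₂ zs) ⟨
    itemsF (xs ++ t₁ ∷ ys ++ t₂ ∷ zs)        ∎
    where
    open PermutationReasoning
    rest = xs ++ ys ++ zs

  links-wellFormed : ∀ {ts out} → Links ts out → All WellFormed ts → All FullRoot ts →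
                     All WellFormed out × All FullRoot out
  links-wellFormed (done _) ws fulls = ws , fulls
  links-wellFormed (step {xs} {ys} {zs} {t₁} {t₂} l ls) ws fulls
    with All-resp-↭ (two-to-front xs t₁ ys t₂ zs) ws
       | All-resp-↭ (two-to-front xs t₁ ys t₂ zs) fulls
  ... | w₁ ∷ w₂ ∷ ws′ | full₁ ∷ full₂ ∷ fulls′ with link-wellFormed l full₁ full₂ w₁ w₂
  ... | w , full = links-wellFormed ls (w ∷ ws′) (full ∷ fulls′)

  pick-contents : ∀ {ts h} → PickMin ts h → contents h ↭ itemsF ts
  pick-contents none                     = ↭-refl
  pick-contents (pick {xs} {t} {ys} _)   = ↭-sym (itemsF-↭ (shift t xs ys))

  pick-shaped : ∀ {ts h} → PickMin ts h → All WellFormed ts → All FullRoot ts → Shaped h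
  pick-shaped none _ _ = shaped [] (lift tt) (lift tt)
  pick-shaped (pick {xs} {t} {ys} below) ws fulls
    with All-resp-↭ (shift t xs ys) ws | All-resp-↭ (shift t xs ys) fulls
  ... | ws′ | full ∷ _ = shaped ws′ full below

  cleanup-contents : ∀ {ts h} → Cleanup ts h → contents h ↭ itemsF ts
  cleanup-contents (cleanup dh ls p) =
    ↭-trans (pick-contents p) (↭-trans (links-contents ls) (↭-reflexive (destroy-contents dh)))

  cleanup-shaped : ∀ {ts h} → Cleanup ts h → All WellFormed ts → Shaped h
  cleanup-shaped (cleanup dh ls p) ws
    with links-wellFormed ls (destroy-wellFormed dh ws) (destroy-fullRoots dh)
  ... | ws′ , fulls′ = pick-shaped p ws′ fulls′

  destroy-∷ : ∀ {t ts out} → FullRoot t → DestroyHollow ts out → DestroyHollow (t ∷ ts) (t ∷ out)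
  destroy-∷ full      (done fulls)   = done (full ∷ fulls)
  destroy-∷ {t} full  (step {xs} dh) = step {xs = t ∷ xs} (destroy-∷ full dh)

  destroy-++ : ∀ {xs ys out₁ out₂} → DestroyHollow xs out₁ → DestroyHollow ys out₂ →
               DestroyHollow (xs ++ ys) (out₁ ++ out₂)
  destroy-++ (done [])             dh₂ = dh₂
  destroy-++ (done (full ∷ fulls)) dh₂ = destroy-∷ full (destroy-++ (done fulls) dh₂)
  destroy-++ {ys = ys} {out₁} {out₂} (step {xs} {ys′} {k} {r} {d} {cs} dh₁) dh₂ =
    cast (sym (++-assoc xs (node (info nothing k r d) cs ∷ ys′) ys))
      (step (cast (trans (++-assoc xs (cs ++ ys′) ys) (cong (xs ++_) (++-assoc cs ys′ ys)))
                  (destroy-++ dh₁ dh₂)))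
    where
    cast : ∀ {ts ts′} → ts ≡ ts′ →
           DestroyHollow ts (out₁ ++ out₂) → DestroyHollow ts′ (out₁ ++ out₂)
    cast = subst (λ ts → DestroyHollow ts (out₁ ++ out₂))

  destroy-exists : ∀ ts → ∃ (DestroyHollow ts)
  destroy-exists []                                  = [] , done []
  destroy-exists (node (info nothing _ _ _) cs ∷ ts) =
    _ , step {xs = []} (destroy-++ (proj₂ (destroy-exists cs)) (proj₂ (destroy-exists ts)))
  destroy-exists (node (info (just e) _ _ _) _ ∷ ts) =
    _ , destroy-∷ (e , refl) (proj₂ (destroy-exists ts))

  data EqualRanks (ts : List Tree) : Set (a ⊔ c) where
    equalRanks : ∀ xs t₁ ys t₂ zs → rankT t₁ ≡ rankT t₂ →
                 ts ≡ xs ++ t₁ ∷ ys ++ t₂ ∷ zs → EqualRanks ts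

  distinctRanks-or-equal : ∀ ts → AllPairs (λ t u → rankT t ≢ rankT u) ts ⊎ EqualRanks ts
  distinctRanks-or-equal []       = inj₁ []
  distinctRanks-or-equal (t ∷ ts) with any? (λ u → rankT t ≟ rankT u) ts
  ... | yes some with find some
  ...   | u , u∈ts , r≡ with ∈-∃++ u∈ts
  ...     | ys , zs , refl = inj₂ (equalRanks [] t ys u zs r≡ refl)
  distinctRanks-or-equal (t ∷ ts) | no ¬some with distinctRanks-or-equal ts
  ... | inj₁ distinct = inj₁ (All.¬Any⇒All¬ ts ¬some ∷ distinct)
  ... | inj₂ (equalRanks xs t₁ ys t₂ zs r≡ refl) =
    inj₂ (equalRanks (t ∷ xs) t₁ ys t₂ zs r≡ refl)

  link-exists : ∀ t₁ t₂ → rankT t₁ ≡ rankT t₂ → ∃ (RankedLink t₁ t₂)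
  link-exists (node i₁ _) (node i₂ _) r≡ with ≤ᴷ-total (key i₁) (key i₂)
  ... | inj₁ k₁≤k₂ = _ , win₁ r≡ k₁≤k₂
  ... | inj₂ k₂≤k₁ = _ , win₂ r≡ k₂≤k₁

  links-exists : ∀ ts → ∃ (Links ts)
  links-exists ts = go ts (<-wellFounded (length ts))
    where
    go : ∀ ts → Acc _<_ (length ts) → ∃ (Links ts)
    go ts (acc shorter) with distinctRanks-or-equal ts
    ... | inj₁ distinct = ts , done distinct
    ... | inj₂ (equalRanks xs t₁ ys t₂ zs r≡ refl) with link-exists t₁ t₂ r≡
    ...   | t , l = map₂ (step l) (go (t ∷ xs ++ ys ++ zs) (shorter fewer))
      where
      fewer : length (t ∷ xs ++ ys ++ zs) < length (xs ++ t₁ ∷ ys ++ t₂ ∷ zs)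
      fewer = subst (_ <_) (sym (↭-length (two-to-front xs t₁ ys t₂ zs))) (n<1+n _)

  minimum-split : ∀ t ts → Σ (List Tree) λ xs → Σ Tree λ m → Σ (List Tree) λ ys →
                  (t ∷ ts ≡ xs ++ m ∷ ys) × All (AtLeast (keyT m)) (xs ++ ys)
  minimum-split t []       = [] , t , [] , refl , []
  minimum-split t (u ∷ us) with minimum-split u us
  ... | xs , m , ys , split , below with ≤ᴷ-total (keyT t) (keyT m)
  ...   | inj₁ t≤m = [] , t , u ∷ us , refl ,
            subst (All (AtLeast (keyT t))) (sym split)
                  (All-resp-↭ (↭-sym (shift m xs ys)) (t≤m ∷ All.map (≤ᴷ-trans t≤m) below))
  ...   | inj₂ m≤t = t ∷ xs , m , ys , cong (t ∷_) split , m≤t ∷ below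

  pick-exists : ∀ ts → ∃ (PickMin ts)
  pick-exists []       = empty , none
  pick-exists (t ∷ ts) with minimum-split t ts
  ... | xs , m , ys , split , below =
    _ , subst (λ ts′ → PickMin ts′ (heap m (xs ++ ys))) (sym split) (pick below)

  cleanup-exists : ∀ ts → ∃ (Cleanup ts)
  cleanup-exists ts with destroy-exists ts
  ... | ts₁ , dh with links-exists ts₁
  ... | ts₂ , ls with pick-exists ts₂
  ... | h , p = h , cleanup dh ls p

  delete-contents : ∀ {e h h′} → Delete e h h′ → Σ Key λ k → Σ (List (Item × Key)) λ rest →
                    (contents h ↭ (e , k) ∷ rest) × (contents h′ ↭ rest)
  delete-contents (inMinTree {i} {ts = ts} hl) with hollowedL-items hl
  ... | k , p = k , _ , ++⁺ʳ (itemsF ts) (extract-past (held i) p) , ↭-refl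
  delete-contents (inOthers {m} hl) with hollowedL-items hl
  ... | k , p = k , _ , extract-past (itemsT m) p , ↭-refl
  delete-contents (atMin {k} cl) = k , _ , ↭-refl , cleanup-contents cl

  delete-shaped : ∀ {e h h′} → Delete e h h′ → Shaped h → Shaped h′
  delete-shaped (inMinTree {i} hl) (shaped (node wf wcs ∷ ws) full below) =
    shaped (node (wellFormedAt-resp {i} (hollowedL-roots hl) wf) (hollowedL-wellFormed hl wcs) ∷ ws)
           full below
  delete-shaped (inOthers {m} hl) (shaped (wm ∷ ws) full below) =
    shaped (wm ∷ hollowedL-wellFormed hl ws) full
           (sameRoots-All {P = keyT m ≤ᴷ_} (hollowedL-roots hl) below)
  delete-shaped (atMin cl) (shaped (node (ord , rankOK , refl) wcs ∷ ws) _ _) =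
    cleanup-shaped cl (node (ord , rankOK , tt) wcs ∷ ws)

  delete-correct : ∀ {e h h′} → Valid h → Delete e h h′ →
    Valid h′ × Σ Key λ k → Σ (List (Item × Key)) λ rest →
                 (contents h ↭ (e , k) ∷ rest) × (contents h′ ↭ rest)
  delete-correct (s , u) d with delete-contents d
  ... | k , rest , before , after with unique-resp-↭ before u
  ... | _ ∷ u-rest = (delete-shaped d s , unique-resp-↭ (↭-sym after) u-rest) , k , rest , before , after

  delete-nonMin-exists : ∀ {e k₀ i} cs ts → (e , k₀) ∈ itemsF cs ++ itemsF ts →
                         ∃ (Delete e (heap (node i cs) ts))
  delete-nonMin-exists cs ts mem with ∈-++⁻ (itemsF cs) mem
  ... | inj₁ mem′ = _ , inMinTree (proj₂ (hollowedL-exists cs mem′))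
  ... | inj₂ mem′ = _ , inOthers (proj₂ (hollowedL-exists ts mem′))

  delete-exists : ∀ {e h} → e ∈ itemsOf h → ∃ (Delete e h)
  delete-exists {h = h} e∈ with ∈-map⁻ proj₁ e∈
  ... | _ , mem , refl = go h mem
    where
    go : ∀ {e k₀} h → (e , k₀) ∈ contents h → ∃ (Delete e h)
    go (heap (node (info (just _) _ _ _) _)  _)  (here refl) = _ , atMin (proj₂ (cleanup-exists _))
    go (heap (node (info (just _) _ _ _) cs) ts) (there mem) = delete-nonMin-exists cs ts mem
    go (heap (node (info nothing _ _ _) cs)  ts) mem         = delete-nonMin-exists cs ts mem

  deleteMin-exists : ∀ {h} → MinFull h → h ≢ empty → ∃ (DeleteMin h)
  deleteMin-exists {empty}      _          h≢empty = ⊥-elim (h≢empty refl)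
  deleteMin-exists {heap (node _ _) _} (_ , refl) _ = _ , deleteMin refl (atMin (proj₂ (cleanup-exists _)))

  deleteMin-contents : ∀ {h h′} → DeleteMin h h′ →
    Σ Item λ e → Σ Key λ k → Σ (List (Item × Key)) λ rest →
      (findMin h ≡ just e) × (contents h ↭ (e , k) ∷ rest) × (contents h′ ↭ rest)
  deleteMin-contents (deleteMin {e} found d) with delete-contents d
  ... | k , rest , before , after = e , k , rest , found , before , after

  reachable⇒valid : ∀ {h} → Reachable h → Valid h
  reachable⇒valid make                          = shaped [] (lift tt) (lift tt) , []
  reachable⇒valid (insert {e} {k} r e∉ ins)     =
    meld-valid (singleton-valid e k) (reachable⇒valid r) (λ { (here refl) → e∉ }) ins
  reachable⇒valid (meld r₁ r₂ disjoint m)       =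
    meld-valid (reachable⇒valid r₁) (reachable⇒valid r₂) disjoint m
  reachable⇒valid (decreaseKey r mem lt d)      = proj₁ (decreaseKey-correct (reachable⇒valid r) mem lt d)
  reachable⇒valid (delete r _ d)                = proj₁ (delete-correct (reachable⇒valid r) d)
  reachable⇒valid (deleteMin r (deleteMin _ d)) = proj₁ (delete-correct (reachable⇒valid r) d)

theorem2p1 : ∀ {a c ℓ₁ ℓ₂ : Level} (Item : Set a) (O : TotalOrder c ℓ₁ ℓ₂) →
    let open HollowHeap Item O in
    (h : Heap) → Reachable h →
      Invariant h
      × (findMin h ≡ nothing → contents h ≡ [])
      × (∀ e → findMin h ≡ just e →
           Σ Key λ k → (e , k) ∈ contents h × All (λ p → k ≤ᴷ proj₂ p) (contents h))
      × (∀ e k → e ∉ itemsOf h →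
           (∃ λ h' → Insert e k h h')
           × (∀ h' → Insert e k h h' → contents h' ↭ (e , k) ∷ contents h))
      × (∀ h₂ → Reachable h₂ → Disjoint h h₂ →
           (∃ λ h' → Meld h h₂ h')
           × (∀ h' → Meld h h₂ h' → contents h' ↭ contents h ++ contents h₂))
      × (∀ e k₀ k → (e , k₀) ∈ contents h → k <ᴷ k₀ →
           (∃ λ h' → DecreaseKey e k h h')
           × (∀ h' → DecreaseKey e k h h' →
                Σ (List (Item × Key)) λ rest →
                  (contents h ↭ (e , k₀) ∷ rest) × (contents h' ↭ (e , k) ∷ rest)))
      × (∀ e → e ∈ itemsOf h →
           (∃ λ h' → Delete e h h')
           × (∀ h' → Delete e h h' →
                Σ Key λ k → Σ (List (Item × Key)) λ rest →
                  (contents h ↭ (e , k) ∷ rest) × (contents h' ↭ rest)))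
      × (h ≢ empty →
           (∃ λ h' → DeleteMin h h')
           × (∀ h' → DeleteMin h h' →
                Σ Item λ e → Σ Key λ k → Σ (List (Item × Key)) λ rest →
                  (findMin h ≡ just e) × (contents h ↭ (e , k) ∷ rest) × (contents h' ↭ rest)))
theorem2p1 Item O h reachable =
  shaped⇒invariant S ,
  findMin-nothing (Shaped.minFull S) ,
  (λ _ → findMin-just (shaped⇒invariant S)) ,
  (λ e k _ → meld-exists (singleton e k) h , λ _ → meld-contents) ,
  (λ h₂ _ _ → meld-exists h h₂ , λ _ → meld-contents) ,
  (λ _ _ k mem lt → decreaseKey-exists k mem , λ _ d → proj₂ (decreaseKey-correct V mem lt d)) ,
  (λ _ e∈ → delete-exists e∈ , λ _ d → proj₂ (delete-correct V d)) ,
  (λ h≢empty → deleteMin-exists (Shaped.minFull S) h≢empty , λ _ → deleteMin-contents)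
  where
  open HollowHeap Item O
  open Correctness Item O
  V = reachable⇒valid reachable
  S = proj₁ V
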